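{- The relation $\rhd_{rm}$ is confluent: for any well-formed suspension expressions $s,u,v$ with $s\rhd_{rm}^* u$ and $s\rhd_{rm}^* v$, there is an expression $t$ with $u\rhd_{rm}^* t$ and $v\rhd_{rm}^* t$.
   Context: Suspension calculus with meta variables. Terms $t ::= c \mid v \mid \#i \mid (t\ t)\mid(\lambda\, t)\mid [\![t,n,n,e]\!]$, environments $e::= nil\mid ((t,n)::e)\mid \{\!\{e,n,n,e\}\!\}$ ($c$ constants, $v$ meta variables, $n$ naturals, $i$ positive integers). $m\mathbin{\dot- } n=\max(m-n,0)$. Length: $len(nil)=0$, $len((t,l)::e)=1+len(e)$, $len(\{\!\{e_1,nl_1,ol_2,e_2\}\!\})=len(e_1)+(len(e_2)\mathbin{\dot- } nl_1)$. Level: $lev(nil)=0$, $lev((t,l)::e)=l$, $lev(\{\!\{e_1,nl_1,ol_2,e_2\}\!\})=lev(e_2)+(nl_1\mathbin{\dot- } ol_2)$. Well-formed: every subexpression satisfies: $[\![t,ol,nl,e]\!]$ has $len(e)=ol$, $lev(e)\le nl$; $(t,l)::e$ has $l\ge lev(e)$; $\{\!\{e_1,nl_1,ol_2,e_2\}\!\}$ has $lev(e_1)\le nl_1$, $len(e_2)=ol_2$. Only well-formed expressions are considered. Reading rules: (r1) $[\![c,ol,nl,e]\!]\to c$; (r2) $[\![\#i,0,nl,nil]\!]\to\#(i+nl)$; (r3) $[\![\#1,ol,nl,(t,l)::e]\!]\to[\![t,0,nl-l,nil]\!]$; (r4) $[\![\#i,ol,nl,(t,l)::e]\!]\to[\![\#(i-1),ol-1,nl,e]\!]$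 if $i>1$; (r5) $[\![(t_1\ t_2),ol,nl,e]\!]\to([\![t_1,ol,nl,e]\!]\ [\![t_2,ol,nl,e]\!])$; (r6) $[\![(\lambda t),ol,nl,e]\!]\to(\lambda [\![t,ol+1,nl+1,(\#1,nl+1)::e]\!])$. Merging rules: (m1) $[\![[\![t,ol_1,nl_1,e_1]\!],ol_2,nl_2,e_2]\!]\to[\![t,ol_1+(ol_2\mathbin{\dot- } nl_1),nl_2+(nl_1\mathbin{\dot- } ol_2),\{\!\{e_1,nl_1,ol_2,e_2\}\!\}]\!]$; (m2) $\{\!\{e_1,nl_1,0,nil\}\!\}\to e_1$; (m3) $\{\!\{nil,0,ol_2,e_2\}\!\}\to e_2$; (m4) $\{\!\{nil,nl_1,ol_2,(t,l)::e_2\}\!\}\to\{\!\{nil,nl_1-1,ol_2-1,e_2\}\!\}$ if $nl_1\ge1$; (m5) $\{\!\{(t,n)::e_1,nl_1,ol_2,(s,l)::e_2\}\!\}\to\{\!\{(t,n)::e_1,nl_1-1,ol_2-1,e_2\}\!\}$ if $nl_1>n$; (m6) $\{\!\{(t,n)::e_1,n,ol_2,(s,l)::e_2\}\!\}\to([\![t,ol_2,l,(s,l)::e_2]\!],l+(n\mathbin{\dot- } ol_2))::\{\!\{e_1,n,ol_2,(s,l)::e_2\}\!\}$. No rule acts on meta variables. $x\rhd_{rm}y$: $y$ results from $x$ by one of these rules at some subexpression; $\rhd_{rm}^*$ is its reflexive–transitive closure. -}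

module Defs where

open import Data.Nat using (ℕ; zero; suc; _+_; _∸_; _≤_; _<_; _>_; _≥_)
open import Relation.Binary.PropositionalEquality using (_≡_)
open import Relation.Binary.Construct.Closure.ReflexiveTransitive using (Star)

data Sort : Set where
  tm env : Sort

data Exp : Sort → Set where
  con   : ℕ → Exp tm
  meta  : ℕ → Exp tm
  #_    : ℕ → Exp tm                                  -- #i  (i ≥ 1 enforced by WF)
  app   : Exp tm → Exp tm → Exp tm
  lam   : Exp tm → Exp tm
  susp  : Exp tm → ℕ → ℕ → Exp env → Exp tm           -- [[t, ol, nl, e]]
  nil   : Exp env
  cons  : Exp tm → ℕ → Exp env → Exp env              -- (t, l) :: e
  menv  : Exp env → ℕ → ℕ → Exp env → Exp env         -- {{e1, nl1, ol2, e2}}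

len : Exp env → ℕ
len nil = 0
len (cons t l e) = suc (len e)
len (menv e₁ nl₁ ol₂ e₂) = len e₁ + (len e₂ ∸ nl₁)

lev : Exp env → ℕ
lev nil = 0
lev (cons t l e) = l
lev (menv e₁ nl₁ ol₂ e₂) = lev e₂ + (nl₁ ∸ ol₂)

data WF : {s : Sort} → Exp s → Set where
  wf-con  : ∀ {c} → WF (con c)
  wf-meta : ∀ {v} → WF (meta v)
  wf-#    : ∀ {i} → 1 ≤ i → WF (# i)
  wf-app  : ∀ {t₁ t₂} → WF t₁ → WF t₂ → WF (app t₁ t₂)
  wf-lam  : ∀ {t} → WF t → WF (lam t)
  wf-susp : ∀ {t ol nl e} → WF t → WF e → len e ≡ ol → lev e ≤ nl → WF (susp t ol nl e)
  wf-nil  : WF nil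
  wf-cons : ∀ {t l e} → WF t → WF e → l ≥ lev e → WF (cons t l e)
  wf-menv : ∀ {e₁ nl₁ ol₂ e₂} → WF e₁ → WF e₂ → lev e₁ ≤ nl₁ → len e₂ ≡ ol₂
          → WF (menv e₁ nl₁ ol₂ e₂)

infix 4 _▷_
data _▷_ : {s : Sort} → Exp s → Exp s → Set where
  r1 : ∀ {c ol nl e} → susp (con c) ol nl e ▷ con c
  r2 : ∀ {i nl} → susp (# i) 0 nl nil ▷ # (i + nl)
  r3 : ∀ {ol nl t l e} → susp (# 1) ol nl (cons t l e) ▷ susp t 0 (nl ∸ l) nil
  r4 : ∀ {i ol nl t l e} → i > 1 → susp (# i) ol nl (cons t l e) ▷ susp (# (i ∸ 1)) (ol ∸ 1) nl e
  r5 : ∀ {t₁ t₂ ol nl e} → susp (app t₁ t₂) ol nl e ▷ app (susp t₁ ol nl e) (susp t₂ ol nl e)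
  r6 : ∀ {t ol nl e} → susp (lam t) ol nl e ▷ lam (susp t (suc ol) (suc nl) (cons (# 1) (suc nl) e))
  m1 : ∀ {t ol₁ nl₁ e₁ ol₂ nl₂ e₂} →
       susp (susp t ol₁ nl₁ e₁) ol₂ nl₂ e₂ ▷
       susp t (ol₁ + (ol₂ ∸ nl₁)) (nl₂ + (nl₁ ∸ ol₂)) (menv e₁ nl₁ ol₂ e₂)
  m2 : ∀ {e₁ nl₁} → menv e₁ nl₁ 0 nil ▷ e₁
  m3 : ∀ {ol₂ e₂} → menv nil 0 ol₂ e₂ ▷ e₂
  m4 : ∀ {nl₁ ol₂ t l e₂} → nl₁ ≥ 1 → menv nil nl₁ ol₂ (cons t l e₂) ▷ menv nil (nl₁ ∸ 1) (ol₂ ∸ 1) e₂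
  m5 : ∀ {t n e₁ nl₁ ol₂ s l e₂} → nl₁ > n →
       menv (cons t n e₁) nl₁ ol₂ (cons s l e₂) ▷ menv (cons t n e₁) (nl₁ ∸ 1) (ol₂ ∸ 1) e₂
  m6 : ∀ {t n e₁ ol₂ s l e₂} →
       menv (cons t n e₁) n ol₂ (cons s l e₂) ▷
       cons (susp t ol₂ l (cons s l e₂)) (l + (n ∸ ol₂)) (menv e₁ n ol₂ (cons s l e₂))
  app₁  : ∀ {t t' u} → t ▷ t' → app t u ▷ app t' u
  app₂  : ∀ {t u u'} → u ▷ u' → app t u ▷ app t u'
  lam₁  : ∀ {t t'} → t ▷ t' → lam t ▷ lam t'
  susp₁ : ∀ {t t' ol nl e} → t ▷ t' → susp t ol nl e ▷ susp t' ol nl e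
  susp₂ : ∀ {t ol nl e e'} → e ▷ e' → susp t ol nl e ▷ susp t ol nl e'
  cons₁ : ∀ {t t' l e} → t ▷ t' → cons t l e ▷ cons t' l e
  cons₂ : ∀ {t l e e'} → e ▷ e' → cons t l e ▷ cons t l e'
  menv₁ : ∀ {e₁ e₁' nl ol e₂} → e₁ ▷ e₁' → menv e₁ nl ol e₂ ▷ menv e₁' nl ol e₂
  menv₂ : ∀ {e₁ nl ol e₂ e₂'} → e₂ ▷ e₂' → menv e₁ nl ol e₂ ▷ menv e₁ nl ol e₂'

infix 4 _▷*_
_▷*_ : {s : Sort} → Exp s → Exp s → Set
_▷*_ = Star _▷_

-- Every well-formed expression x reduces to an explicitly computed normal form nf x, and
-- nf is invariant under each rule; hence if s reduces to u and to v, both reduce to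
-- nf u = nf s = nf v.  Invariance under m1 is the substance of the proof: it amounts to
-- associativity of suspNf over mergeNf (and of mergeNf itself), proved by a simultaneous
-- induction on the total size of the three arguments.
module Submission where

open import Data.Bool using (true; false; if_then_else_)
open import Data.Bool.Properties using (T-≡)
open import Data.Nat using (ℕ; zero; suc; _+_; _∸_; _≤_; _<_; z≤n; s≤s; _<ᵇ_; _≡ᵇ_)
open import Data.Nat.Properties
open import Data.Nat.Tactic.RingSolver using (solve-∀)
open import Data.Product using (∃; _×_; _,_; proj₁; proj₂)
open import Data.Sum using (_⊎_; inj₁; inj₂)
open import Function.Bundles using (Equivalence)
open import Relation.Binary.Construct.Closure.ReflexiveTransitive using (ε; _◅_; _◅◅_; gmap; return)
open import Relation.Binary.PropositionalEquality

open import Defs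

-- Normal forms

shiftEnv : ℕ → ℕ → Exp env
shiftEnv k zero = nil
shiftEnv k (suc j) = cons (# 1) (suc (j + k)) (shiftEnv k j)

shiftVarNf : ℕ → ℕ → ℕ → ℕ → Exp tm
shiftVarNf k i nl zero = # (i + nl)
shiftVarNf k zero nl (suc j) = # 0
shiftVarNf k (suc zero) nl (suc j) = # (1 + (nl ∸ suc (j + k)))
shiftVarNf k (suc (suc i)) nl (suc j) = shiftVarNf k (suc i) nl j

-- shiftNf and shiftMergeNf are suspNf and mergeNf specialised to shiftEnv (see shiftNf≡suspNf);
-- they are defined separately so that varNf, which normalises an entry of its environment,
-- does not make the recursion of suspNf non-structural.
mutual
  shiftNf : ℕ → ℕ → Exp tm → Exp tm
  shiftNf j k (con c) = con c
  shiftNf j k (meta v) = susp (meta v) j (j + k) (shiftEnv k j)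
  shiftNf j k (# i) = shiftVarNf k i (j + k) j
  shiftNf j k (app t u) = app (shiftNf j k t) (shiftNf j k u)
  shiftNf j k (lam t) = lam (shiftNf (suc j) k t)
  shiftNf j k (susp (meta v) ol nl e) = susp (meta v) (ol + (j ∸ nl)) ((j + k) + (nl ∸ j)) (shiftMergeNf e nl j k)
  shiftNf j k (susp t ol nl e) = susp (susp t ol nl e) j (j + k) (shiftEnv k j)

  shiftMergeNf : Exp env → ℕ → ℕ → ℕ → Exp env
  shiftMergeNf e₁ nl₁ zero k = e₁
  shiftMergeNf nil zero (suc j) k = shiftEnv k (suc j)
  shiftMergeNf nil (suc nl₁) (suc j) k = shiftMergeNf nil nl₁ j k
  shiftMergeNf (cons t n e₁) nl₁ (suc j) k =
    if n <ᵇ nl₁ then shiftMergeNf (cons t n e₁) (nl₁ ∸ 1) j k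
    else (if nl₁ ≡ᵇ n then cons (shiftNf (suc j) k t) (suc (j + k) + (n ∸ suc j)) (shiftMergeNf e₁ n (suc j) k)
          else menv (cons t n e₁) nl₁ (suc j) (shiftEnv k (suc j)))
  shiftMergeNf (menv e e' n n') nl₁ (suc j) k = menv (menv e e' n n') nl₁ (suc j) (shiftEnv k (suc j))

-- # 0 is a junk value: i = 0 and merged environments do not occur in well-formed normal input.
varNf : ℕ → ℕ → Exp env → Exp tm
varNf i nl nil = # (i + nl)
varNf zero nl (cons t l e) = # 0
varNf (suc zero) nl (cons t l e) = shiftNf 0 (nl ∸ l) t
varNf (suc (suc i)) nl (cons t l e) = varNf (suc i) nl e
varNf i nl (menv _ _ _ _) = # 0

-- For normal arguments, suspNf t ol nl e is the normal form of [[t, ol, nl, e]] and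
-- mergeNf e₁ nl₁ ol₂ e₂ that of {{e₁, nl₁, ol₂, e₂}}; the menv results are junk, since
-- well-formedness rules out an entry level above nl₁.
mutual
  suspNf : Exp tm → ℕ → ℕ → Exp env → Exp tm
  suspNf (con c) ol nl e = con c
  suspNf (meta v) ol nl e = susp (meta v) ol nl e
  suspNf (# i) ol nl e = varNf i nl e
  suspNf (app t u) ol nl e = app (suspNf t ol nl e) (suspNf u ol nl e)
  suspNf (lam t) ol nl e = lam (suspNf t (suc ol) (suc nl) (cons (# 1) (suc nl) e))
  suspNf (susp (meta v) ol₁ nl₁ e₁) ol nl e = susp (meta v) (ol₁ + (ol ∸ nl₁)) (nl + (nl₁ ∸ ol)) (mergeNf e₁ nl₁ ol e)
  suspNf (susp t ol₁ nl₁ e₁) ol nl e = susp (susp t ol₁ nl₁ e₁) ol nl e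

  mergeNf : Exp env → ℕ → ℕ → Exp env → Exp env
  mergeNf e₁ nl₁ ol₂ nil = e₁
  mergeNf nil zero ol₂ (cons s l e₂) = cons s l e₂
  mergeNf nil (suc nl₁) ol₂ (cons s l e₂) = mergeNf nil nl₁ (ol₂ ∸ 1) e₂
  mergeNf (cons t n e₁) nl₁ ol₂ (cons s l e₂) =
    if n <ᵇ nl₁ then mergeNf (cons t n e₁) (nl₁ ∸ 1) (ol₂ ∸ 1) e₂
    else (if nl₁ ≡ᵇ n then cons (suspNf t ol₂ l (cons s l e₂)) (l + (n ∸ ol₂)) (mergeNf e₁ n ol₂ (cons s l e₂))
          else menv (cons t n e₁) nl₁ ol₂ (cons s l e₂))
  mergeNf e₁ nl₁ ol₂ e₂ = menv e₁ nl₁ ol₂ e₂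

nf : ∀ {σ} → Exp σ → Exp σ
nf (con c) = con c
nf (meta v) = meta v
nf (# i) = # i
nf (app t u) = app (nf t) (nf u)
nf (lam t) = lam (nf t)
nf (susp t ol nl e) = suspNf (nf t) ol nl (nf e)
nf nil = nil
nf (cons t l e) = cons (nf t) l (nf e)
nf (menv e₁ nl ol e₂) = mergeNf (nf e₁) nl ol (nf e₂)

mutual
  data NormalTm : Exp tm → Set where
    con  : ∀ {c} → NormalTm (con c)
    meta : ∀ {v} → NormalTm (meta v)
    var  : ∀ {i} → NormalTm (# i)
    app  : ∀ {t u} → NormalTm t → NormalTm u → NormalTm (app t u)
    lam  : ∀ {t} → NormalTm t → NormalTm (lam t)
    susp : ∀ {v ol nl e} → NormalEnv e → NormalTm (susp (meta v) ol nl e)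

  data NormalEnv : Exp env → Set where
    nil  : NormalEnv nil
    cons : ∀ {t l e} → NormalTm t → NormalEnv e → NormalEnv (cons t l e)

Normal : ∀ {σ} → Exp σ → Set
Normal {tm} = NormalTm
Normal {env} = NormalEnv

-- Subject reduction

▷-len : ∀ {e e' : Exp env} → e ▷ e' → WF e → len e' ≡ len e
▷-len {menv e₁ nl₁ _ nil} m2 _ = trans (sym (+-identityʳ (len e₁))) (cong (len e₁ +_) (sym (0∸n≡0 nl₁)))
▷-len m3 _ = refl
▷-len (m4 (s≤s _)) _ = refl
▷-len (m5 (s≤s _)) _ = refl
▷-len m6 _ = refl
▷-len (cons₁ _) _ = refl
▷-len (cons₂ r) (wf-cons _ w _) = cong suc (▷-len r w)
▷-len (menv₁ r) (wf-menv w _ _ _) = cong (_+ _) (▷-len r w)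
▷-len {menv _ nl _ _} (menv₂ r) (wf-menv _ w _ _) = cong (λ x → _ + (x ∸ nl)) (▷-len r w)

▷-lev : ∀ {e e' : Exp env} → e ▷ e' → WF e → lev e' ≤ lev e
▷-lev m2 (wf-menv _ _ le _) = le
▷-lev {menv nil _ ol e₂} m3 _ = m≤m+n (lev e₂) (0 ∸ ol)
▷-lev (m4 (s≤s _)) (wf-menv _ (wf-cons _ _ le) _ refl) = +-monoˡ-≤ _ le
▷-lev (m5 (s≤s _)) (wf-menv _ (wf-cons _ _ le) _ refl) = +-monoˡ-≤ _ le
▷-lev m6 _ = ≤-refl
▷-lev (cons₁ _) _ = ≤-refl
▷-lev (cons₂ _) _ = ≤-refl
▷-lev (menv₁ _) _ = ≤-refl
▷-lev (menv₂ r) (wf-menv _ w _ _) = +-monoˡ-≤ _ (▷-lev r w)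

wf-#suc : ∀ {i} → WF (# suc i)
wf-#suc = wf-# (s≤s z≤n)

▷-WF : ∀ {σ} {x y : Exp σ} → x ▷ y → WF x → WF y
▷-WF r1 _ = wf-con
▷-WF {x = susp (# i) _ nl _} r2 (wf-susp (wf-# p) _ _ _) = wf-# (≤-trans p (m≤m+n i nl))
▷-WF r3 (wf-susp _ (wf-cons wt _ _) _ _) = wf-susp wt wf-nil refl z≤n
▷-WF (r4 (s≤s (s≤s _))) (wf-susp _ (wf-cons _ we le) refl le') = wf-susp wf-#suc we refl (≤-trans le le')
▷-WF r5 (wf-susp (wf-app w₁ w₂) we l₁ l₂) = wf-app (wf-susp w₁ we l₁ l₂) (wf-susp w₂ we l₁ l₂)
▷-WF r6 (wf-susp (wf-lam w) we refl le) = wf-lam (wf-susp w (wf-cons wf-#suc we (m≤n⇒m≤1+n le)) refl ≤-refl)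
▷-WF m1 (wf-susp (wf-susp wt we₁ refl le₁) we₂ refl le₂) =
  wf-susp wt (wf-menv we₁ we₂ le₁ refl) refl (+-monoˡ-≤ _ le₂)
▷-WF m2 (wf-menv w _ _ _) = w
▷-WF m3 (wf-menv _ w _ _) = w
▷-WF (m4 (s≤s _)) (wf-menv w (wf-cons _ w₂ _) _ refl) = wf-menv w w₂ z≤n refl
▷-WF (m5 (s≤s p)) (wf-menv w (wf-cons _ w₂ _) _ refl) = wf-menv w w₂ p refl
▷-WF m6 (wf-menv (wf-cons wt we₁ le₁) w₂ _ refl) =
  wf-cons (wf-susp wt w₂ refl ≤-refl) (wf-menv we₁ w₂ le₁ refl) ≤-refl
▷-WF (app₁ r) (wf-app w₁ w₂) = wf-app (▷-WF r w₁) w₂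
▷-WF (app₂ r) (wf-app w₁ w₂) = wf-app w₁ (▷-WF r w₂)
▷-WF (lam₁ r) (wf-lam w) = wf-lam (▷-WF r w)
▷-WF (susp₁ r) (wf-susp w we l₁ l₂) = wf-susp (▷-WF r w) we l₁ l₂
▷-WF (susp₂ r) (wf-susp w we l₁ l₂) = wf-susp w (▷-WF r we) (trans (▷-len r we) l₁) (≤-trans (▷-lev r we) l₂)
▷-WF (cons₁ r) (wf-cons w we l) = wf-cons (▷-WF r w) we l
▷-WF (cons₂ r) (wf-cons w we l) = wf-cons w (▷-WF r we) (≤-trans (▷-lev r we) l)
▷-WF (menv₁ r) (wf-menv w₁ w₂ l₁ l₂) = wf-menv (▷-WF r w₁) w₂ (≤-trans (▷-lev r w₁) l₁) l₂
▷-WF (menv₂ r) (wf-menv w₁ w₂ l₁ l₂) = wf-menv w₁ (▷-WF r w₂) l₁ (trans (▷-len r w₂) l₂)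

▷*-WF : ∀ {σ} {x y : Exp σ} → x ▷* y → WF x → WF y
▷*-WF ε w = w
▷*-WF (r ◅ rs) w = ▷*-WF rs (▷-WF r w)

▷*-len : ∀ {e e' : Exp env} → e ▷* e' → WF e → len e' ≡ len e
▷*-len ε w = refl
▷*-len (r ◅ rs) w = trans (▷*-len rs (▷-WF r w)) (▷-len r w)

▷*-lev : ∀ {e e' : Exp env} → e ▷* e' → WF e → lev e' ≤ lev e
▷*-lev ε w = ≤-refl
▷*-lev (r ◅ rs) w = ≤-trans (▷*-lev rs (▷-WF r w)) (▷-lev r w)

-- Reduction to normal form

≡⇒▷* : ∀ {σ} {x y : Exp σ} → x ≡ y → x ▷* y
≡⇒▷* refl = ε

app-▷* : ∀ {t t' u u'} → t ▷* t' → u ▷* u' → app t u ▷* app t' u'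
app-▷* p q = gmap _ app₁ p ◅◅ gmap _ app₂ q

lam-▷* : ∀ {t t'} → t ▷* t' → lam t ▷* lam t'
lam-▷* = gmap lam lam₁

susp-▷* : ∀ {t t' ol nl e e'} → t ▷* t' → e ▷* e' → susp t ol nl e ▷* susp t' ol nl e'
susp-▷* p q = gmap _ susp₁ p ◅◅ gmap _ susp₂ q

cons-▷* : ∀ {t t' l e e'} → t ▷* t' → e ▷* e' → cons t l e ▷* cons t' l e'
cons-▷* p q = gmap _ cons₁ p ◅◅ gmap _ cons₂ q

menv-▷* : ∀ {e₁ e₁' nl ol e₂ e₂'} → e₁ ▷* e₁' → e₂ ▷* e₂' → menv e₁ nl ol e₂ ▷* menv e₁' nl ol e₂'
menv-▷* p q = gmap _ menv₁ p ◅◅ gmap _ menv₂ q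

<ᵇ-irrefl : ∀ n → (n <ᵇ n) ≡ false
<ᵇ-irrefl zero = refl
<ᵇ-irrefl (suc n) = <ᵇ-irrefl n

<⇒<ᵇ≡true : ∀ {m n} → m < n → (m <ᵇ n) ≡ true
<⇒<ᵇ≡true p = Equivalence.to T-≡ (<⇒<ᵇ p)

≡ᵇ-refl : ∀ n → (n ≡ᵇ n) ≡ true
≡ᵇ-refl n = Equivalence.to T-≡ (≡⇒≡ᵇ n n refl)

mergeNf-cons-< : ∀ {t n e₁ nl₁ ol₂ s l e₂} → n < nl₁ →
                 mergeNf (cons t n e₁) nl₁ ol₂ (cons s l e₂) ≡ mergeNf (cons t n e₁) (nl₁ ∸ 1) (ol₂ ∸ 1) e₂
mergeNf-cons-< p rewrite <⇒<ᵇ≡true p = refl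

mergeNf-cons-≡ : ∀ {t n e₁ ol₂ s l e₂} →
                 mergeNf (cons t n e₁) n ol₂ (cons s l e₂) ≡
                 cons (suspNf t ol₂ l (cons s l e₂)) (l + (n ∸ ol₂)) (mergeNf e₁ n ol₂ (cons s l e₂))
mergeNf-cons-≡ {n = n} rewrite <ᵇ-irrefl n | ≡ᵇ-refl n = refl

shiftMergeNf-cons-< : ∀ {t n e₁ nl₁ j k} → n < nl₁ →
                      shiftMergeNf (cons t n e₁) nl₁ (suc j) k ≡ shiftMergeNf (cons t n e₁) (nl₁ ∸ 1) j k
shiftMergeNf-cons-< p rewrite <⇒<ᵇ≡true p = refl

shiftMergeNf-cons-≡ : ∀ {t n e₁ j k} →
                      shiftMergeNf (cons t n e₁) n (suc j) k ≡
                      cons (shiftNf (suc j) k t) (suc (j + k) + (n ∸ suc j)) (shiftMergeNf e₁ n (suc j) k)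
shiftMergeNf-cons-≡ {n = n} rewrite <ᵇ-irrefl n | ≡ᵇ-refl n = refl

▷*-shiftVarNf : ∀ k i nl j → 1 ≤ i → susp (# i) j nl (shiftEnv k j) ▷* shiftVarNf k i nl j
▷*-shiftVarNf k i nl zero _ = return r2
▷*-shiftVarNf k (suc zero) nl (suc j) _ = r3 ◅ return r2
▷*-shiftVarNf k (suc (suc i)) nl (suc j) _ = r4 (s≤s (s≤s z≤n)) ◅ ▷*-shiftVarNf k (suc i) nl j (s≤s z≤n)

mutual
  ▷*-shiftNf : ∀ j k {t} → NormalTm t → WF t → susp t j (j + k) (shiftEnv k j) ▷* shiftNf j k t
  ▷*-shiftNf j k con _ = return r1
  ▷*-shiftNf j k meta _ = ε
  ▷*-shiftNf j k (var {i}) (wf-# p) = ▷*-shiftVarNf k i (j + k) j p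
  ▷*-shiftNf j k (app nt nu) (wf-app wt wu) = r5 ◅ app-▷* (▷*-shiftNf j k nt wt) (▷*-shiftNf j k nu wu)
  ▷*-shiftNf j k (lam nt) (wf-lam wt) = r6 ◅ lam-▷* (▷*-shiftNf (suc j) k nt wt)
  ▷*-shiftNf j k (susp ne) (wf-susp _ we _ le) = m1 ◅ susp-▷* ε (▷*-shiftMergeNf k ne we le j)

  ▷*-shiftMergeNf : ∀ k {e} → NormalEnv e → WF e → ∀ {nl} → lev e ≤ nl → ∀ j →
                    menv e nl j (shiftEnv k j) ▷* shiftMergeNf e nl j k
  ▷*-shiftMergeNf k _ _ _ zero = return m2
  ▷*-shiftMergeNf k nil _ {zero} _ (suc j) = return m3
  ▷*-shiftMergeNf k nil w {suc nl} _ (suc j) = m4 (s≤s z≤n) ◅ ▷*-shiftMergeNf k nil w z≤n j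
  ▷*-shiftMergeNf k ne@(cons _ _) w le (suc j) = ▷*-shiftMergeNf-cons k ne w j (m≤n⇒m<n∨m≡n le)

  ▷*-shiftMergeNf-cons : ∀ k {t n e} → NormalEnv (cons t n e) → WF (cons t n e) → ∀ {nl} j → n < nl ⊎ n ≡ nl →
                         menv (cons t n e) nl (suc j) (shiftEnv k (suc j)) ▷* shiftMergeNf (cons t n e) nl (suc j) k
  ▷*-shiftMergeNf-cons k ne w j (inj₁ p@(s≤s q)) =
    m5 p ◅ ▷*-shiftMergeNf k ne w q j ◅◅ ≡⇒▷* (sym (shiftMergeNf-cons-< p))
  ▷*-shiftMergeNf-cons k {t} {n} {e} (cons nt ne) (wf-cons wt w le) j (inj₂ refl) =
    m6 ◅ cons-▷* (▷*-shiftNf (suc j) k nt wt) (▷*-shiftMergeNf k ne w le (suc j))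
       ◅◅ ≡⇒▷* (sym (shiftMergeNf-cons-≡ {t} {n} {e}))

▷*-varNf : ∀ i {ol nl e} → 1 ≤ i → NormalEnv e → WF e → len e ≡ ol → susp (# i) ol nl e ▷* varNf i nl e
▷*-varNf i _ nil _ refl = return r2
▷*-varNf (suc zero) {nl = nl} _ (cons {l = l} nt _) (wf-cons wt _ _) refl = r3 ◅ ▷*-shiftNf 0 (nl ∸ l) nt wt
▷*-varNf (suc (suc i)) _ (cons _ ne) (wf-cons _ we _) refl = r4 (s≤s (s≤s z≤n)) ◅ ▷*-varNf (suc i) (s≤s z≤n) ne we refl

mutual
  ▷*-suspNf : ∀ {t} → NormalTm t → WF t → ∀ {ol nl e} → NormalEnv e → WF e → len e ≡ ol → lev e ≤ nl →
              susp t ol nl e ▷* suspNf t ol nl e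
  ▷*-suspNf con _ _ _ _ _ = return r1
  ▷*-suspNf meta _ _ _ _ _ = ε
  ▷*-suspNf (var {i}) (wf-# p) ne we eq _ = ▷*-varNf i p ne we eq
  ▷*-suspNf (app nt nu) (wf-app wt wu) ne we eq le =
    r5 ◅ app-▷* (▷*-suspNf nt wt ne we eq le) (▷*-suspNf nu wu ne we eq le)
  ▷*-suspNf (lam nt) (wf-lam wt) ne we eq le =
    r6 ◅ lam-▷* (▷*-suspNf nt wt (cons var ne) (wf-cons wf-#suc we (m≤n⇒m≤1+n le)) (cong suc eq) ≤-refl)
  ▷*-suspNf (susp ne₁) (wf-susp _ we₁ _ le₁) ne we eq _ = m1 ◅ susp-▷* ε (▷*-mergeNf ne₁ we₁ le₁ ne we eq)

  ▷*-mergeNf : ∀ {e₁} → NormalEnv e₁ → WF e₁ → ∀ {nl₁ ol₂ e₂} → lev e₁ ≤ nl₁ →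
               NormalEnv e₂ → WF e₂ → len e₂ ≡ ol₂ →
               menv e₁ nl₁ ol₂ e₂ ▷* mergeNf e₁ nl₁ ol₂ e₂
  ▷*-mergeNf _ _ _ nil _ refl = return m2
  ▷*-mergeNf nil _ {zero} _ (cons _ _) _ _ = return m3
  ▷*-mergeNf nil w₁ {suc nl₁} _ (cons _ ne₂) (wf-cons _ w₂ _) refl =
    m4 (s≤s z≤n) ◅ ▷*-mergeNf nil w₁ z≤n ne₂ w₂ refl
  ▷*-mergeNf ne₁@(cons _ _) w₁ le₁ ne₂@(cons _ _) w₂ eq = ▷*-mergeNf-cons ne₁ w₁ ne₂ w₂ eq (m≤n⇒m<n∨m≡n le₁)

  ▷*-mergeNf-cons : ∀ {t n e₁} → NormalEnv (cons t n e₁) → WF (cons t n e₁) →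
                    ∀ {nl₁ ol₂ s l e₂} → NormalEnv (cons s l e₂) → WF (cons s l e₂) → len (cons s l e₂) ≡ ol₂ →
                    n < nl₁ ⊎ n ≡ nl₁ →
                    menv (cons t n e₁) nl₁ ol₂ (cons s l e₂) ▷* mergeNf (cons t n e₁) nl₁ ol₂ (cons s l e₂)
  ▷*-mergeNf-cons ne₁ w₁ (cons _ ne₂) (wf-cons _ w₂ _) refl (inj₁ p@(s≤s q)) =
    m5 p ◅ ▷*-mergeNf ne₁ w₁ q ne₂ w₂ refl ◅◅ ≡⇒▷* (sym (mergeNf-cons-< p))
  ▷*-mergeNf-cons {t} {n} {e₁} (cons nt ne₁) (wf-cons wt w₁ le₁) ne₂ w₂ refl (inj₂ refl) =
    m6 ◅ cons-▷* (▷*-suspNf nt wt ne₂ w₂ refl ≤-refl) (▷*-mergeNf ne₁ w₁ le₁ ne₂ w₂ refl)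
       ◅◅ ≡⇒▷* (sym (mergeNf-cons-≡ {t} {n} {e₁}))

shiftEnv-normal : ∀ k j → NormalEnv (shiftEnv k j)
shiftEnv-normal k zero = nil
shiftEnv-normal k (suc j) = cons var (shiftEnv-normal k j)

shiftVarNf-normal : ∀ k i nl j → NormalTm (shiftVarNf k i nl j)
shiftVarNf-normal k i nl zero = var
shiftVarNf-normal k zero nl (suc j) = var
shiftVarNf-normal k (suc zero) nl (suc j) = var
shiftVarNf-normal k (suc (suc i)) nl (suc j) = shiftVarNf-normal k (suc i) nl j

mutual
  shiftNf-normal : ∀ j k {t} → NormalTm t → WF t → NormalTm (shiftNf j k t)
  shiftNf-normal j k con _ = con
  shiftNf-normal j k meta _ = susp (shiftEnv-normal k j)
  shiftNf-normal j k (var {i}) _ = shiftVarNf-normal k i (j + k) j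
  shiftNf-normal j k (app nt nu) (wf-app wt wu) = app (shiftNf-normal j k nt wt) (shiftNf-normal j k nu wu)
  shiftNf-normal j k (lam nt) (wf-lam wt) = lam (shiftNf-normal (suc j) k nt wt)
  shiftNf-normal j k (susp ne) (wf-susp _ we _ le) = susp (shiftMergeNf-normal k ne we le j)

  shiftMergeNf-normal : ∀ k {e} → NormalEnv e → WF e → ∀ {nl} → lev e ≤ nl → ∀ j → NormalEnv (shiftMergeNf e nl j k)
  shiftMergeNf-normal k ne _ _ zero = ne
  shiftMergeNf-normal k nil _ {zero} _ (suc j) = shiftEnv-normal k (suc j)
  shiftMergeNf-normal k nil w {suc nl} _ (suc j) = shiftMergeNf-normal k nil w z≤n j
  shiftMergeNf-normal k ne@(cons _ _) w le (suc j) = shiftMergeNf-cons-normal k ne w j (m≤n⇒m<n∨m≡n le)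

  shiftMergeNf-cons-normal : ∀ k {t n e} → NormalEnv (cons t n e) → WF (cons t n e) → ∀ {nl} j → n < nl ⊎ n ≡ nl →
                             NormalEnv (shiftMergeNf (cons t n e) nl (suc j) k)
  shiftMergeNf-cons-normal k ne w j (inj₁ p@(s≤s q)) =
    subst NormalEnv (sym (shiftMergeNf-cons-< p)) (shiftMergeNf-normal k ne w q j)
  shiftMergeNf-cons-normal k {t} {n} {e} (cons nt ne) (wf-cons wt w le) j (inj₂ refl) =
    subst NormalEnv (sym (shiftMergeNf-cons-≡ {t} {n} {e}))
          (cons (shiftNf-normal (suc j) k nt wt) (shiftMergeNf-normal k ne w le (suc j)))

varNf-normal : ∀ i nl {e} → NormalEnv e → WF e → NormalTm (varNf i nl e)
varNf-normal i nl nil _ = var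
varNf-normal zero nl (cons _ _) _ = var
varNf-normal (suc zero) nl (cons {l = l} nt _) (wf-cons wt _ _) = shiftNf-normal 0 (nl ∸ l) nt wt
varNf-normal (suc (suc i)) nl (cons _ ne) (wf-cons _ we _) = varNf-normal (suc i) nl ne we

mutual
  suspNf-normal : ∀ {t} → NormalTm t → WF t → ∀ {ol nl e} → NormalEnv e → WF e → lev e ≤ nl → NormalTm (suspNf t ol nl e)
  suspNf-normal con _ _ _ _ = con
  suspNf-normal meta _ ne _ _ = susp ne
  suspNf-normal (var {i}) _ {nl = nl} ne we _ = varNf-normal i nl ne we
  suspNf-normal (app nt nu) (wf-app wt wu) ne we le = app (suspNf-normal nt wt ne we le) (suspNf-normal nu wu ne we le)
  suspNf-normal (lam nt) (wf-lam wt) ne we le =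
    lam (suspNf-normal nt wt (cons var ne) (wf-cons wf-#suc we (m≤n⇒m≤1+n le)) ≤-refl)
  suspNf-normal (susp ne₁) (wf-susp _ we₁ _ le₁) ne we _ = susp (mergeNf-normal ne₁ we₁ le₁ ne we)

  mergeNf-normal : ∀ {e₁} → NormalEnv e₁ → WF e₁ → ∀ {nl₁ ol₂ e₂} → lev e₁ ≤ nl₁ →
                   NormalEnv e₂ → WF e₂ →
                   NormalEnv (mergeNf e₁ nl₁ ol₂ e₂)
  mergeNf-normal ne₁ _ _ nil _ = ne₁
  mergeNf-normal nil _ {zero} _ ne₂@(cons _ _) _ = ne₂
  mergeNf-normal nil w₁ {suc nl₁} _ (cons _ ne₂) (wf-cons _ w₂ _) = mergeNf-normal nil w₁ z≤n ne₂ w₂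
  mergeNf-normal ne₁@(cons _ _) w₁ le₁ ne₂@(cons _ _) w₂ = mergeNf-cons-normal ne₁ w₁ ne₂ w₂ (m≤n⇒m<n∨m≡n le₁)

  mergeNf-cons-normal : ∀ {t n e₁} → NormalEnv (cons t n e₁) → WF (cons t n e₁) →
                        ∀ {nl₁ ol₂ s l e₂} → NormalEnv (cons s l e₂) → WF (cons s l e₂) → n < nl₁ ⊎ n ≡ nl₁ →
                        NormalEnv (mergeNf (cons t n e₁) nl₁ ol₂ (cons s l e₂))
  mergeNf-cons-normal {t} {n} {e₁} ne₁ w₁ {nl₁} {ol₂} {s} {l} {e₂} (cons _ ne₂) (wf-cons _ w₂ _) (inj₁ p@(s≤s q)) =
    subst NormalEnv (sym (mergeNf-cons-< {t} {n} {e₁} {nl₁} {ol₂} {s} {l} {e₂} p))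
          (mergeNf-normal ne₁ w₁ q ne₂ w₂)
  mergeNf-cons-normal {t} {n} {e₁} (cons nt ne₁) (wf-cons wt w₁ le₁) {ol₂ = ol₂} {s} {l} {e₂} ne₂ w₂ (inj₂ refl) =
    subst NormalEnv (sym (mergeNf-cons-≡ {t} {n} {e₁} {ol₂} {s} {l} {e₂}))
          (cons (suspNf-normal nt wt ne₂ w₂ ≤-refl) (mergeNf-normal ne₁ w₁ le₁ ne₂ w₂))

mutual
  ▷*-nf : ∀ {σ} {x : Exp σ} → WF x → x ▷* nf x
  ▷*-nf wf-con = ε
  ▷*-nf wf-meta = ε
  ▷*-nf (wf-# _) = ε
  ▷*-nf (wf-app wt wu) = app-▷* (▷*-nf wt) (▷*-nf wu)
  ▷*-nf (wf-lam wt) = lam-▷* (▷*-nf wt)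
  ▷*-nf (wf-susp wt we refl le) =
    susp-▷* (▷*-nf wt) (▷*-nf we) ◅◅
    ▷*-suspNf (nf-normal wt) (nf-WF wt) (nf-normal we) (nf-WF we) (▷*-len (▷*-nf we) we) (≤-trans (nf-lev we) le)
  ▷*-nf wf-nil = ε
  ▷*-nf (wf-cons wt we _) = cons-▷* (▷*-nf wt) (▷*-nf we)
  ▷*-nf (wf-menv w₁ w₂ le refl) =
    menv-▷* (▷*-nf w₁) (▷*-nf w₂) ◅◅
    ▷*-mergeNf (nf-normal w₁) (nf-WF w₁) (≤-trans (nf-lev w₁) le) (nf-normal w₂) (nf-WF w₂) (▷*-len (▷*-nf w₂) w₂)

  nf-normal : ∀ {σ} {x : Exp σ} → WF x → Normal (nf x)
  nf-normal wf-con = con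
  nf-normal wf-meta = meta
  nf-normal (wf-# _) = var
  nf-normal (wf-app wt wu) = app (nf-normal wt) (nf-normal wu)
  nf-normal (wf-lam wt) = lam (nf-normal wt)
  nf-normal (wf-susp wt we refl le) =
    suspNf-normal (nf-normal wt) (nf-WF wt) (nf-normal we) (nf-WF we) (≤-trans (nf-lev we) le)
  nf-normal wf-nil = nil
  nf-normal (wf-cons wt we _) = cons (nf-normal wt) (nf-normal we)
  nf-normal (wf-menv w₁ w₂ le refl) =
    mergeNf-normal (nf-normal w₁) (nf-WF w₁) (≤-trans (nf-lev w₁) le) (nf-normal w₂) (nf-WF w₂)

  nf-WF : ∀ {σ} {x : Exp σ} → WF x → WF (nf x)
  nf-WF w = ▷*-WF (▷*-nf w) w

  nf-lev : ∀ {e : Exp env} → WF e → lev (nf e) ≤ lev e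
  nf-lev w = ▷*-lev (▷*-nf w) w

shiftVarNf≡varNf : ∀ k i nl j → 1 ≤ i → shiftVarNf k i nl j ≡ varNf i nl (shiftEnv k j)
shiftVarNf≡varNf k i nl zero _ = refl
shiftVarNf≡varNf k (suc zero) nl (suc j) _ = refl
shiftVarNf≡varNf k (suc (suc i)) nl (suc j) _ = shiftVarNf≡varNf k (suc i) nl j (s≤s z≤n)

mutual
  shiftNf≡suspNf : ∀ j k {t} → NormalTm t → WF t → shiftNf j k t ≡ suspNf t j (j + k) (shiftEnv k j)
  shiftNf≡suspNf j k con _ = refl
  shiftNf≡suspNf j k meta _ = refl
  shiftNf≡suspNf j k (var {i}) (wf-# p) = shiftVarNf≡varNf k i (j + k) j p
  shiftNf≡suspNf j k (app nt nu) (wf-app wt wu) = cong₂ app (shiftNf≡suspNf j k nt wt) (shiftNf≡suspNf j k nu wu)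
  shiftNf≡suspNf j k (lam nt) (wf-lam wt) = cong lam (shiftNf≡suspNf (suc j) k nt wt)
  shiftNf≡suspNf j k (susp ne) (wf-susp _ we _ le) = cong (susp _ _ _) (shiftMergeNf≡mergeNf k ne we le j)

  shiftMergeNf≡mergeNf : ∀ k {e} → NormalEnv e → WF e → ∀ {nl} → lev e ≤ nl → ∀ j →
                         shiftMergeNf e nl j k ≡ mergeNf e nl j (shiftEnv k j)
  shiftMergeNf≡mergeNf k ne _ _ zero = refl
  shiftMergeNf≡mergeNf k nil _ {zero} _ (suc j) = refl
  shiftMergeNf≡mergeNf k nil w {suc nl} _ (suc j) = shiftMergeNf≡mergeNf k nil w z≤n j
  shiftMergeNf≡mergeNf k ne@(cons _ _) w le (suc j) = shiftMergeNf≡mergeNf-cons k ne w j (m≤n⇒m<n∨m≡n le)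

  shiftMergeNf≡mergeNf-cons : ∀ k {t n e} → NormalEnv (cons t n e) → WF (cons t n e) → ∀ {nl} j → n < nl ⊎ n ≡ nl →
                              shiftMergeNf (cons t n e) nl (suc j) k ≡ mergeNf (cons t n e) nl (suc j) (shiftEnv k (suc j))
  shiftMergeNf≡mergeNf-cons k {t} {n} {e} ne w {nl} j (inj₁ p@(s≤s q)) = begin
    shiftMergeNf (cons t n e) nl (suc j) k             ≡⟨ shiftMergeNf-cons-< p ⟩
    shiftMergeNf (cons t n e) (nl ∸ 1) j k             ≡⟨ shiftMergeNf≡mergeNf k ne w q j ⟩
    mergeNf (cons t n e) (nl ∸ 1) j (shiftEnv k j)     ≡⟨ mergeNf-cons-< p ⟨
    mergeNf (cons t n e) nl (suc j) (shiftEnv k (suc j)) ∎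
    where open ≡-Reasoning
  shiftMergeNf≡mergeNf-cons k {t} {n} {e} (cons nt ne) (wf-cons wt w le) j (inj₂ refl) = begin
    shiftMergeNf (cons t n e) n (suc j) k
      ≡⟨ shiftMergeNf-cons-≡ {t} {n} {e} {j} {k} ⟩
    cons (shiftNf (suc j) k t) (suc (j + k) + (n ∸ suc j)) (shiftMergeNf e n (suc j) k)
      ≡⟨ cong₂ (λ t' e' → cons t' _ e') (shiftNf≡suspNf (suc j) k nt wt) (shiftMergeNf≡mergeNf k ne w le (suc j)) ⟩
    cons (suspNf t (suc j) (suc (j + k)) (shiftEnv k (suc j))) (suc (j + k) + (n ∸ suc j))
         (mergeNf e n (suc j) (shiftEnv k (suc j)))
      ≡⟨ mergeNf-cons-≡ {t} {n} {e} {suc j} {# 1} {suc (j + k)} {shiftEnv k j} ⟨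
    mergeNf (cons t n e) n (suc j) (shiftEnv k (suc j)) ∎
    where open ≡-Reasoning

module _ {e₁ : Exp env} (ne₁ : NormalEnv e₁) (w₁ : WF e₁) {nl₁ : ℕ} (le₁ : lev e₁ ≤ nl₁)
         {e₂ : Exp env} (ne₂ : NormalEnv e₂) (w₂ : WF e₂) where
  private
    ▷*-merge : menv e₁ nl₁ (len e₂) e₂ ▷* mergeNf e₁ nl₁ (len e₂) e₂
    ▷*-merge = ▷*-mergeNf ne₁ w₁ le₁ ne₂ w₂ refl

    wf-merge : WF (menv e₁ nl₁ (len e₂) e₂)
    wf-merge = wf-menv w₁ w₂ le₁ refl

  mergeNf-WF : WF (mergeNf e₁ nl₁ (len e₂) e₂)
  mergeNf-WF = ▷*-WF ▷*-merge wf-merge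

  len-mergeNf : len (mergeNf e₁ nl₁ (len e₂) e₂) ≡ len e₁ + (len e₂ ∸ nl₁)
  len-mergeNf = ▷*-len ▷*-merge wf-merge

  lev-mergeNf : lev (mergeNf e₁ nl₁ (len e₂) e₂) ≤ lev e₂ + (nl₁ ∸ len e₂)
  lev-mergeNf = ▷*-lev ▷*-merge wf-merge

suspNf-WF : ∀ {t} → NormalTm t → WF t → ∀ {nl e} → NormalEnv e → WF e → lev e ≤ nl → WF (suspNf t (len e) nl e)
suspNf-WF nt wt ne we le = ▷*-WF (▷*-suspNf nt wt ne we refl le) (wf-susp wt we refl le)

-- Normal environments

drop : ℕ → Exp env → Exp env
drop zero e = e
drop (suc d) nil = nil
drop (suc d) (cons t l e) = drop d e
drop (suc d) (menv e₁ nl ol e₂) = menv e₁ nl ol e₂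

drop-nil : ∀ d → drop d nil ≡ nil
drop-nil zero = refl
drop-nil (suc d) = refl

drop-normal : ∀ d {e} → NormalEnv e → NormalEnv (drop d e)
drop-normal zero ne = ne
drop-normal (suc d) nil = nil
drop-normal (suc d) (cons _ ne) = drop-normal d ne

drop-WF : ∀ d {e} → WF e → WF (drop d e)
drop-WF zero w = w
drop-WF (suc d) wf-nil = wf-nil
drop-WF (suc d) (wf-cons _ w _) = drop-WF d w
drop-WF (suc d) w@(wf-menv _ _ _ _) = w

len-drop : ∀ d {e} → NormalEnv e → len (drop d e) ≡ len e ∸ d
len-drop zero ne = refl
len-drop (suc d) nil = refl
len-drop (suc d) (cons _ ne) = len-drop d ne

lev-drop : ∀ d {e} → WF e → lev (drop d e) ≤ lev e
lev-drop zero w = ≤-refl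
lev-drop (suc d) wf-nil = ≤-refl
lev-drop (suc d) (wf-cons _ w le) = ≤-trans (lev-drop d w) le
lev-drop (suc d) (wf-menv _ _ _ _) = ≤-refl

drop-drop : ∀ a b {e} → NormalEnv e → drop a (drop b e) ≡ drop (b + a) e
drop-drop a zero ne = refl
drop-drop a (suc b) nil = drop-nil a
drop-drop a (suc b) (cons _ ne) = drop-drop a b ne

drop≡nil⇒len≤ : ∀ d {e} → NormalEnv e → drop d e ≡ nil → len e ≤ d
drop≡nil⇒len≤ zero nil _ = z≤n
drop≡nil⇒len≤ (suc d) nil _ = z≤n
drop≡nil⇒len≤ (suc d) (cons _ ne) eq = s≤s (drop≡nil⇒len≤ d ne eq)

len≤⇒drop≡nil : ∀ d {e} → NormalEnv e → len e ≤ d → drop d e ≡ nil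
len≤⇒drop≡nil zero nil _ = refl
len≤⇒drop≡nil (suc d) nil _ = refl
len≤⇒drop≡nil (suc d) (cons _ ne) (s≤s p) = len≤⇒drop≡nil d ne p

drop-cons⇒<len : ∀ d {e s l f} → NormalEnv e → drop d e ≡ cons s l f → d < len e
drop-cons⇒<len d ne eq = m∸n≢0⇒n<m (λ len≡0 → 1+n≢0 (trans (cong len (sym eq)) (trans (len-drop d ne) len≡0)))

mergeNf-nil : ∀ nl ol {e} → NormalEnv e → mergeNf nil nl ol e ≡ drop nl e
mergeNf-nil zero ol nil = refl
mergeNf-nil (suc nl) ol nil = refl
mergeNf-nil zero ol (cons _ _) = refl
mergeNf-nil (suc nl) ol (cons _ ne) = mergeNf-nil nl (ol ∸ 1) ne

mergeNf-skip : ∀ {e₁} → NormalEnv e₁ → ∀ {nl} → lev e₁ ≤ nl → ∀ ol {s l e₂} →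
               mergeNf e₁ (suc nl) ol (cons s l e₂) ≡ mergeNf e₁ nl (ol ∸ 1) e₂
mergeNf-skip nil _ ol = refl
mergeNf-skip (cons _ _) le ol = mergeNf-cons-< (s≤s le)

mergeNf-drop : ∀ d {e₁} → NormalEnv e₁ → ∀ {nl} → lev e₁ ≤ nl → ∀ ol {e₂} → NormalEnv e₂ →
               mergeNf e₁ (d + nl) ol e₂ ≡ mergeNf e₁ nl (ol ∸ d) (drop d e₂)
mergeNf-drop zero ne₁ le ol ne₂ = refl
mergeNf-drop (suc d) ne₁ le ol nil = refl
mergeNf-drop (suc d) {e₁} ne₁ {nl} le ol (cons {e = e₂} _ ne₂) = begin
  mergeNf e₁ (suc d + nl) ol (cons _ _ e₂)         ≡⟨ mergeNf-skip ne₁ (≤-trans le (m≤n+m nl d)) ol ⟩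
  mergeNf e₁ (d + nl) (ol ∸ 1) e₂                  ≡⟨ mergeNf-drop d ne₁ le (ol ∸ 1) ne₂ ⟩
  mergeNf e₁ nl (ol ∸ 1 ∸ d) (drop d e₂)           ≡⟨ cong (λ o → mergeNf e₁ nl o (drop d e₂)) (∸-+-assoc ol 1 d) ⟩
  mergeNf e₁ nl (ol ∸ suc d) (drop d e₂)           ∎
  where open ≡-Reasoning

Entry : Set
Entry = Exp tm × ℕ

consEntry : Entry → Exp env → Exp env
consEntry p e = cons (proj₁ p) (proj₂ p) e

-- In a merge with nl₁ = nl, the head entry (t, n) of the first environment is suspended
-- against what remains of the second one after nl ∸ n entries are skipped (mergeNf-cons).
mergeEntry : Exp tm → ℕ → Exp env → Entry
mergeEntry t n e@(cons s l _) = suspNf t (len e) l e , l + (n ∸ len e)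
mergeEntry t n _ = t , n

mutual
  mergeNf-cons : ∀ {t n e₁} → NormalEnv e₁ → lev e₁ ≤ n → ∀ {nl} → n ≤ nl → ∀ {e₂} → NormalEnv e₂ →
                 mergeNf (cons t n e₁) nl (len e₂) e₂ ≡
                 consEntry (mergeEntry t n (drop (nl ∸ n) e₂)) (mergeNf e₁ nl (len e₂) e₂)
  mergeNf-cons {t} {n} {e₁} _ _ {nl} _ nil = cong (λ e → consEntry (mergeEntry t n e) e₁) (sym (drop-nil (nl ∸ n)))
  mergeNf-cons ne₁ le₁ le ne₂@(cons _ _) = mergeNf-cons-cons ne₁ le₁ le ne₂ (m≤n⇒m<n∨m≡n le)

  mergeNf-cons-cons : ∀ {t n e₁} → NormalEnv e₁ → lev e₁ ≤ n → ∀ {nl} → n ≤ nl →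
                      ∀ {s l e₂} → NormalEnv (cons s l e₂) →
                      n < nl ⊎ n ≡ nl →
                      mergeNf (cons t n e₁) nl (len (cons s l e₂)) (cons s l e₂) ≡
                      consEntry (mergeEntry t n (drop (nl ∸ n) (cons s l e₂))) (mergeNf e₁ nl (len (cons s l e₂)) (cons s l e₂))
  mergeNf-cons-cons {t} {n} {e₁} ne₁ le₁ {suc nl} _ {s} {l} {e₂} (cons _ ne₂) (inj₁ p@(s≤s q)) = begin
    mergeNf (cons t n e₁) (suc nl) (suc (len e₂)) (cons s l e₂)
      ≡⟨ mergeNf-cons-< p ⟩
    mergeNf (cons t n e₁) nl (len e₂) e₂
      ≡⟨ mergeNf-cons ne₁ le₁ q ne₂ ⟩
    consEntry (mergeEntry t n (drop (nl ∸ n) e₂)) (mergeNf e₁ nl (len e₂) e₂)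
      ≡⟨ cong₂ (λ d e → consEntry (mergeEntry t n (drop d (cons s l e₂))) e)
               (sym (+-∸-assoc 1 q)) (sym (mergeNf-skip ne₁ (≤-trans le₁ q) (suc (len e₂)))) ⟩
    consEntry (mergeEntry t n (drop (suc nl ∸ n) (cons s l e₂))) (mergeNf e₁ (suc nl) (suc (len e₂)) (cons s l e₂)) ∎
    where open ≡-Reasoning
  mergeNf-cons-cons {t} {n} {e₁} _ _ _ {s} {l} {e₂} _ (inj₂ refl) =
    trans (mergeNf-cons-≡ {t} {n} {e₁} {suc (len e₂)} {s} {l} {e₂})
          (cong (λ d → consEntry (mergeEntry t n (drop d (cons s l e₂))) (mergeNf e₁ n (suc (len e₂)) (cons s l e₂)))
                (sym (n∸n≡0 n)))

drop-mergeNf : ∀ d {e₂} → NormalEnv e₂ → WF e₂ → ∀ {nl₂} → lev e₂ ≤ nl₂ → ∀ {e₃} → NormalEnv e₃ →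
               drop d (mergeNf e₂ nl₂ (len e₃) e₃) ≡ mergeNf (drop d e₂) (nl₂ + (d ∸ len e₂)) (len e₃) e₃
drop-mergeNf zero {e₂} _ _ {nl₂} _ _ rewrite 0∸n≡0 (len e₂) | +-identityʳ nl₂ = refl
drop-mergeNf (suc d) nil _ {nl₂} _ {e₃} ne₃ = begin
  drop (suc d) (mergeNf nil nl₂ (len e₃) e₃)       ≡⟨ cong (drop (suc d)) (mergeNf-nil nl₂ (len e₃) ne₃) ⟩
  drop (suc d) (drop nl₂ e₃)                       ≡⟨ drop-drop (suc d) nl₂ ne₃ ⟩
  drop (nl₂ + suc d) e₃                            ≡⟨ mergeNf-nil (nl₂ + suc d) (len e₃) ne₃ ⟨
  mergeNf nil (nl₂ + suc d) (len e₃) e₃            ∎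
  where open ≡-Reasoning
drop-mergeNf (suc d) (cons _ ne₂) (wf-cons _ w₂ le₂) le ne₃ =
  trans (cong (drop (suc d)) (mergeNf-cons ne₂ le₂ le ne₃)) (drop-mergeNf d ne₂ w₂ (≤-trans le₂ le) ne₃)

mergeNf-exhausted : ∀ {e₂} → NormalEnv e₂ → WF e₂ → ∀ {nl₂} → lev e₂ ≤ nl₂ → ∀ {e₃} → NormalEnv e₃ →
                    len e₃ ≤ nl₂ ∸ lev e₂ → mergeNf e₂ nl₂ (len e₃) e₃ ≡ e₂
mergeNf-exhausted nil _ {nl₂} _ {e₃} ne₃ p = trans (mergeNf-nil nl₂ (len e₃) ne₃) (len≤⇒drop≡nil nl₂ ne₃ p)
mergeNf-exhausted (cons {t} {l} _ ne₂) (wf-cons _ w₂ le₂) {nl₂} le ne₃ p =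
  trans (mergeNf-cons ne₂ le₂ le ne₃)
        (cong₂ (λ e e' → consEntry (mergeEntry t l e) e') (len≤⇒drop≡nil (nl₂ ∸ l) ne₃ p)
               (mergeNf-exhausted ne₂ w₂ (≤-trans le₂ le) ne₃ (≤-trans p (∸-monoʳ-≤ nl₂ le₂))))

varNf-drop : ∀ i d {nl e} → 1 ≤ i → NormalEnv e → varNf (i + d) nl e ≡ varNf i (nl + (d ∸ len e)) (drop d e)
varNf-drop i zero {nl} {e} _ _ rewrite +-identityʳ i | 0∸n≡0 (len e) | +-identityʳ nl = refl
varNf-drop i (suc d) {nl} _ nil = cong #_ (trans (+-assoc i (suc d) nl) (cong (i +_) (+-comm (suc d) nl)))
varNf-drop (suc i) (suc d) _ (cons _ ne) rewrite +-suc i d = varNf-drop (suc i) d (s≤s z≤n) ne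

-- Associativity

[m∸n]∸o≡[m∸o]∸n : ∀ m n o → (m ∸ n) ∸ o ≡ (m ∸ o) ∸ n
[m∸n]∸o≡[m∸o]∸n m n o = trans (∸-+-assoc m n o) (trans (cong (m ∸_) (+-comm n o)) (sym (∸-+-assoc m o n)))

[m+o]∸[n+o]≡m∸n : ∀ m n o → (m + o) ∸ (n + o) ≡ m ∸ n
[m+o]∸[n+o]≡m∸n m n o rewrite +-comm m o | +-comm n o = [m+n]∸[m+o]≡n∸o o m n

[m+n]∸o≡[m∸o]+[n∸[o∸m]] : ∀ m n o → (m + n) ∸ o ≡ (m ∸ o) + (n ∸ (o ∸ m))
[m+n]∸o≡[m∸o]+[n∸[o∸m]] zero n o rewrite 0∸n≡0 o = refl
[m+n]∸o≡[m∸o]+[n∸[o∸m]] (suc m) n zero = refl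
[m+n]∸o≡[m∸o]+[n∸[o∸m]] (suc m) n (suc o) = [m+n]∸o≡[m∸o]+[n∸[o∸m]] m n o

[o∸[n∸m]]∸m≡o∸n : ∀ o {m n} → m ≤ n → (o ∸ (n ∸ m)) ∸ m ≡ o ∸ n
[o∸[n∸m]]∸m≡o∸n o {m} {n} m≤n = trans (∸-+-assoc o (n ∸ m) m) (cong (o ∸_) (m∸n+n≡m m≤n))

[m+n]∸o≡n∸[o∸m] : ∀ {m} n {o} → m ≤ o → (m + n) ∸ o ≡ n ∸ (o ∸ m)
[m+n]∸o≡n∸[o∸m] {m} n {o} m≤o = trans (cong ((m + n) ∸_) (sym (m+[n∸m]≡n m≤o))) ([m+n]∸[m+o]≡n∸o m n (o ∸ m))

[o+[m∸p]]∸n≡o+[[m∸n]∸p] : ∀ o {m n p} → n ≤ m → p ≤ m ∸ n → (o + (m ∸ p)) ∸ n ≡ o + ((m ∸ n) ∸ p)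
[o+[m∸p]]∸n≡o+[[m∸n]∸p] o {m} {n} {p} n≤m p≤m∸n = begin
  (o + (m ∸ p)) ∸ n   ≡⟨ +-∸-assoc o n≤m∸p ⟩
  o + ((m ∸ p) ∸ n)   ≡⟨ cong (o +_) ([m∸n]∸o≡[m∸o]∸n m p n) ⟩
  o + ((m ∸ n) ∸ p)   ∎
  where
  open ≡-Reasoning
  n≤m∸p : n ≤ m ∸ p
  n≤m∸p = m+n≤o⇒m≤o∸n n (subst (_≤ m) (+-comm p n) (m≤o∸n⇒m+n≤o p n≤m p≤m∸n))

n∸[p∸[m∸n]]≡m∸p : ∀ {m n p} → n ≤ m → m ∸ n < p → n ∸ (p ∸ (m ∸ n)) ≡ m ∸ p
n∸[p∸[m∸n]]≡m∸p {m} {n} {p} n≤m m∸n<p =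
  trans (sym ([m+n]∸o≡n∸[o∸m] n (<⇒≤ m∸n<p))) (cong (_∸ p) (m∸n+n≡m n≤m))

m1-ol-assoc : ∀ ol₁ nl₁ ol₂ nl₂ ol₃ →
              (ol₁ + (ol₂ ∸ nl₁)) + (ol₃ ∸ (nl₂ + (nl₁ ∸ ol₂))) ≡ ol₁ + ((ol₂ + (ol₃ ∸ nl₂)) ∸ nl₁)
m1-ol-assoc ol₁ nl₁ ol₂ nl₂ ol₃ = trans (+-assoc ol₁ _ _) (cong (ol₁ +_) (inner ol₂ nl₁ ol₃ nl₂))
  where
  inner : ∀ p a q b → (p ∸ a) + (q ∸ (b + (a ∸ p))) ≡ (p + (q ∸ b)) ∸ a
  inner zero a q b rewrite 0∸n≡0 a = sym (∸-+-assoc q b a)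
  inner (suc p) zero q b = cong (λ x → suc p + (q ∸ x)) (+-identityʳ b)
  inner (suc p) (suc a) q b = inner p a q b

m1-nl-assoc : ∀ nl₁ ol₂ nl₂ ol₃ nl₃ →
              nl₃ + ((nl₂ + (nl₁ ∸ ol₂)) ∸ ol₃) ≡ (nl₃ + (nl₂ ∸ ol₃)) + (nl₁ ∸ (ol₂ + (ol₃ ∸ nl₂)))
m1-nl-assoc nl₁ ol₂ nl₂ ol₃ nl₃ = trans (cong (nl₃ +_) (inner nl₁ ol₂ ol₃ nl₂)) (sym (+-assoc nl₃ _ _))
  where
  inner : ∀ a p q b → (b + (a ∸ p)) ∸ q ≡ (b ∸ q) + (a ∸ (p + (q ∸ b)))
  inner a p q zero rewrite 0∸n≡0 q = ∸-+-assoc a p q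
  inner a p zero (suc b) = cong (λ x → suc b + (a ∸ x)) (sym (+-identityʳ p))
  inner a p (suc q) (suc b) = inner a p q b

-- lam weighs 5 so that the two entries (# 1, _) pushed by r6 still decrease the measure.
size : ∀ {σ} → Exp σ → ℕ
size (con _) = 1
size (meta _) = 1
size (# _) = 1
size (app t u) = suc (size t + size u)
size (lam t) = 5 + size t
size (susp t _ _ e) = suc (size t + size e)
size nil = 1
size (cons t _ e) = suc (size t + size e)
size (menv e₁ _ _ e₂) = suc (size e₁ + size e₂)

size-drop : ∀ d e → size (drop d e) ≤ size e
size-drop zero e = ≤-refl
size-drop (suc d) nil = ≤-refl
size-drop (suc d) (cons t l e) = ≤-trans (size-drop d e) (≤-trans (m≤n+m (size e) (size t)) (n≤1+n _))
size-drop (suc d) (menv _ _ _ _) = ≤-refl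

<-of-≡ : ∀ {m n} k → n ≡ suc (m + k) → m < n
<-of-≡ k refl = s≤s (m≤m+n _ k)

spend : ∀ {m n fuel} → m < n → n < suc fuel → m < fuel
spend m<n (s≤s n≤fuel) = <-≤-trans m<n n≤fuel

+-right-comm : ∀ a b c → a + b + c ≡ a + c + b
+-right-comm = solve-∀

size-appˡ : ∀ a b x y → suc (a + b) + x + y ≡ suc ((a + x + y) + b)
size-appˡ = solve-∀

size-appʳ : ∀ a b x y → suc (a + b) + x + y ≡ suc ((b + x + y) + a)
size-appʳ = solve-∀

size-lam : ∀ a x y → 5 + a + x + y ≡ suc ((a + suc (suc x) + suc (suc y)) + 0)
size-lam = solve-∀

size-susp : ∀ e x y → suc (suc e) + x + y ≡ suc ((e + x + y) + 1)
size-susp = solve-∀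

size-head : ∀ t e y → 1 + suc (t + e) + y ≡ suc ((t + 1 + y) + e)
size-head = solve-∀

size-tail : ∀ t e y → 1 + suc (t + e) + y ≡ suc ((1 + e + y) + t)
size-tail = solve-∀

size-consˡ : ∀ t e y z → suc (t + e) + y + z ≡ suc ((t + y + z) + e)
size-consˡ = solve-∀

size-consʳ : ∀ t e y z → suc (t + e) + y + z ≡ suc ((e + y + z) + t)
size-consʳ = solve-∀

mutual
  suspNf-assoc : ∀ fuel {t} → NormalTm t → WF t → ∀ {nl₁ e₁} → NormalEnv e₁ → WF e₁ → lev e₁ ≤ nl₁ →
                  ∀ {nl₂ e₂} → NormalEnv e₂ → WF e₂ → lev e₂ ≤ nl₂ → size t + size e₁ + size e₂ < fuel →
                  suspNf (suspNf t (len e₁) nl₁ e₁) (len e₂) nl₂ e₂ ≡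
                  suspNf t (len e₁ + (len e₂ ∸ nl₁)) (nl₂ + (nl₁ ∸ len e₂)) (mergeNf e₁ nl₁ (len e₂) e₂)
  suspNf-assoc (suc fuel) con _ _ _ _ _ _ _ _ = refl
  suspNf-assoc (suc fuel) meta _ _ _ _ _ _ _ _ = refl
  suspNf-assoc (suc fuel) (app {a} {b} na nb) (wf-app wa wb) {e₁ = e₁} ne₁ w₁ le₁ {e₂ = e₂} ne₂ w₂ le₂ h =
    cong₂ app (suspNf-assoc fuel na wa ne₁ w₁ le₁ ne₂ w₂ le₂ hˡ)
              (suspNf-assoc fuel nb wb ne₁ w₁ le₁ ne₂ w₂ le₂ hʳ)
    where
    hˡ : size a + size e₁ + size e₂ < fuel
    hˡ = spend (<-of-≡ (size b) (size-appˡ (size a) (size b) (size e₁) (size e₂))) h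
    hʳ : size b + size e₁ + size e₂ < fuel
    hʳ = spend (<-of-≡ (size a) (size-appʳ (size a) (size b) (size e₁) (size e₂))) h
  suspNf-assoc (suc fuel) (lam {a} na) (wf-lam wa) {nl₁} {e₁} ne₁ w₁ le₁ {nl₂} {e₂} ne₂ w₂ le₂ h =
    cong lam (trans (suspNf-assoc fuel na wa (cons var ne₁) (wf-cons wf-#suc w₁ (m≤n⇒m≤1+n le₁)) ≤-refl
                                              (cons var ne₂) (wf-cons wf-#suc w₂ (m≤n⇒m≤1+n le₂)) ≤-refl
                                              (spend (<-of-≡ 0 (size-lam (size a) (size e₁) (size e₂))) h))
                    (cong (suspNf a _ _) merge-r6-entries))
    where
    merge-r6-entries : mergeNf (cons (# 1) (suc nl₁) e₁) (suc nl₁) (suc (len e₂)) (cons (# 1) (suc nl₂) e₂) ≡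
                       cons (# 1) (suc (nl₂ + (nl₁ ∸ len e₂))) (mergeNf e₁ nl₁ (len e₂) e₂)
    merge-r6-entries = trans (mergeNf-cons-≡ {# 1} {suc nl₁} {e₁} {suc (len e₂)} {# 1} {suc nl₂} {e₂})
                             (cong₂ (λ t e → cons t (suc (nl₂ + (nl₁ ∸ len e₂))) e)
                                    (cong (λ i → # suc i) (n∸n≡0 nl₂)) (mergeNf-skip ne₁ le₁ (suc (len e₂))))
  suspNf-assoc (suc fuel) (susp {v} {_} {n} {e} ne) (wf-susp _ we refl le)
               {nl₁} {e₁} ne₁ w₁ le₁ {nl₂} {e₂} ne₂ w₂ le₂ h =
    trans (cong₂ (λ ol nl → susp (meta v) ol nl (mergeNf (mergeNf e n (len e₁) e₁) (nl₁ + (n ∸ len e₁)) (len e₂) e₂))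
                 (m1-ol-assoc (len e) n (len e₁) nl₁ (len e₂)) (m1-nl-assoc n (len e₁) nl₁ (len e₂) nl₂))
          (cong (susp (meta v) _ _) (mergeNf-assoc fuel ne we le ne₁ w₁ le₁ ne₂ w₂ h'))
    where
    h' : size e + size e₁ + size e₂ < fuel
    h' = spend (<-of-≡ 1 (size-susp (size e) (size e₁) (size e₂))) h
  suspNf-assoc (suc fuel) (var {i}) (wf-# p) {nl₁} {nil} nil _ _ {nl₂} {e₂} ne₂ _ _ _ =
    trans (varNf-drop i nl₁ p ne₂) (cong (varNf i (nl₂ + (nl₁ ∸ len e₂))) (sym (mergeNf-nil nl₁ (len e₂) ne₂)))
  suspNf-assoc (suc fuel) (var {suc zero}) _ {nl₁} {cons t l e₁} (cons nt ne₁) (wf-cons wt _ le) le₁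
               {nl₂} {e₂} ne₂ w₂ le₂ h = begin
    suspNf (shiftNf 0 d t) (len e₂) nl₂ e₂
      ≡⟨ cong (λ u → suspNf u (len e₂) nl₂ e₂) (shiftNf≡suspNf 0 d nt wt) ⟩
    suspNf (suspNf t 0 d nil) (len e₂) nl₂ e₂
      ≡⟨ suspNf-assoc fuel nt wt nil wf-nil z≤n ne₂ w₂ le₂ h' ⟩
    suspNf t (len e₂ ∸ d) (nl₂ + (d ∸ len e₂)) (mergeNf nil d (len e₂) e₂)
      ≡⟨ cong (suspNf t (len e₂ ∸ d) (nl₂ + (d ∸ len e₂))) (mergeNf-nil d (len e₂) ne₂) ⟩
    suspNf t (len e₂ ∸ d) (nl₂ + (d ∸ len e₂)) (drop d e₂)
      ≡⟨ suspNf-mergeEntry fuel nt wt le₁ ne₂ w₂ le₂ (drop-normal d ne₂) refl h' ⟩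
    varNf 1 (nl₂ + (nl₁ ∸ len e₂)) (consEntry (mergeEntry t l (drop d e₂)) (mergeNf e₁ nl₁ (len e₂) e₂))
      ≡⟨ cong (varNf 1 (nl₂ + (nl₁ ∸ len e₂))) (mergeNf-cons ne₁ le le₁ ne₂) ⟨
    varNf 1 (nl₂ + (nl₁ ∸ len e₂)) (mergeNf (cons t l e₁) nl₁ (len e₂) e₂) ∎
    where
    open ≡-Reasoning
    d = nl₁ ∸ l
    h' : size t + 1 + size e₂ < fuel
    h' = spend (<-of-≡ (size e₁) (size-head (size t) (size e₁) (size e₂))) h
  suspNf-assoc (suc fuel) (var {suc (suc i)}) _ {nl₁} {cons t l e₁} (cons _ ne₁) (wf-cons _ w₁ le) le₁
               {nl₂} {e₂} ne₂ w₂ le₂ h =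
    trans (suspNf-assoc fuel (var {suc i}) wf-#suc ne₁ w₁ (≤-trans le le₁) ne₂ w₂ le₂
                         (spend (<-of-≡ (size t) (size-tail (size t) (size e₁) (size e₂))) h))
          (cong (varNf (suc (suc i)) (nl₂ + (nl₁ ∸ len e₂))) (sym (mergeNf-cons ne₁ le le₁ ne₂)))

  suspNf-mergeEntry : ∀ fuel {t} → NormalTm t → WF t → ∀ {l nl₁} → l ≤ nl₁ →
                      ∀ {nl₂ e₂} → NormalEnv e₂ → WF e₂ → lev e₂ ≤ nl₂ →
                      ∀ {rest} → NormalEnv rest → drop (nl₁ ∸ l) e₂ ≡ rest → size t + 1 + size e₂ < fuel →
                      suspNf t (len e₂ ∸ (nl₁ ∸ l)) (nl₂ + ((nl₁ ∸ l) ∸ len e₂)) rest ≡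
                      varNf 1 (nl₂ + (nl₁ ∸ len e₂)) (consEntry (mergeEntry t l rest) nil)
  suspNf-mergeEntry fuel {t} nt wt {l} {nl₁} l≤nl₁ {nl₂} {e₂} ne₂ _ _ nil eq _ =
    trans (cong₂ (λ ol nl → suspNf t ol nl nil)
                 (m≤n⇒m∸n≡0 len≤) (sym ([o+[m∸p]]∸n≡o+[[m∸n]∸p] nl₂ l≤nl₁ len≤)))
          (sym (shiftNf≡suspNf 0 ((nl₂ + (nl₁ ∸ len e₂)) ∸ l) nt wt))
    where
    len≤ : len e₂ ≤ nl₁ ∸ l
    len≤ = drop≡nil⇒len≤ (nl₁ ∸ l) ne₂ eq
  suspNf-mergeEntry fuel {t} nt wt {l'} {nl₁} l'≤nl₁ {nl₂} {e₂} ne₂ w₂ le₂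
                    {rest} nr@(cons {l = l} {rest'} _ _) eq h =
    sym (trans (shiftNf≡suspNf 0 k (suspNf-normal nt wt nr wr ≤-refl) (suspNf-WF nt wt nr wr ≤-refl))
               (trans (suspNf-assoc fuel nt wt nr wr ≤-refl nil wf-nil z≤n h')
                      (cong₂ (λ ol nl → suspNf t ol nl rest) ol≡ nl≡)))
    where
    d = nl₁ ∸ l'
    k = (nl₂ + (nl₁ ∸ len e₂)) ∸ (l + (l' ∸ suc (len rest')))
    wr : WF rest
    wr = subst WF eq (drop-WF d w₂)
    len-rest : len rest ≡ len e₂ ∸ d
    len-rest = trans (cong len (sym eq)) (len-drop d ne₂)
    l≤nl₂ : l ≤ nl₂
    l≤nl₂ = ≤-trans (subst (λ e → lev e ≤ lev e₂) eq (lev-drop d w₂)) le₂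
    d<len : d < len e₂
    d<len = drop-cons⇒<len d ne₂ eq
    h' : size t + size rest + 1 < fuel
    h' = ≤-<-trans (≤-trans (+-monoˡ-≤ 1 (+-monoʳ-≤ (size t) (subst (λ e → size e ≤ size e₂) eq (size-drop d e₂))))
                            (≤-reflexive (+-right-comm (size t) (size e₂) 1)))
                   h
    ol≡ : len rest + (0 ∸ l) ≡ len e₂ ∸ d
    ol≡ = trans (cong (len rest +_) (0∸n≡0 l)) (trans (+-identityʳ _) len-rest)
    nl≡ : k + l ≡ nl₂ + (d ∸ len e₂)
    nl≡ = begin
      k + l
        ≡⟨ cong (λ x → (nl₂ + (nl₁ ∸ len e₂)) ∸ (l + (l' ∸ x)) + l) len-rest ⟩
      (nl₂ + (nl₁ ∸ len e₂)) ∸ (l + (l' ∸ (len e₂ ∸ d))) + l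
        ≡⟨ cong (λ x → (nl₂ + (nl₁ ∸ len e₂)) ∸ (l + x) + l) (n∸[p∸[m∸n]]≡m∸p l'≤nl₁ d<len) ⟩
      (nl₂ + (nl₁ ∸ len e₂)) ∸ (l + (nl₁ ∸ len e₂)) + l
        ≡⟨ cong (_+ l) ([m+o]∸[n+o]≡m∸n nl₂ l (nl₁ ∸ len e₂)) ⟩
      nl₂ ∸ l + l
        ≡⟨ m∸n+n≡m l≤nl₂ ⟩
      nl₂
        ≡⟨ +-identityʳ nl₂ ⟨
      nl₂ + 0
        ≡⟨ cong (nl₂ +_) (m≤n⇒m∸n≡0 (<⇒≤ d<len)) ⟨
      nl₂ + (d ∸ len e₂) ∎
      where open ≡-Reasoning

  mergeNf-assoc : ∀ fuel {e₁} → NormalEnv e₁ → WF e₁ → ∀ {nl₁} → lev e₁ ≤ nl₁ →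
                  ∀ {e₂ nl₂} → NormalEnv e₂ → WF e₂ → lev e₂ ≤ nl₂ →
                  ∀ {e₃} → NormalEnv e₃ → WF e₃ → size e₁ + size e₂ + size e₃ < fuel →
                  mergeNf (mergeNf e₁ nl₁ (len e₂) e₂) (nl₂ + (nl₁ ∸ len e₂)) (len e₃) e₃ ≡
                  mergeNf e₁ nl₁ (len e₂ + (len e₃ ∸ nl₂)) (mergeNf e₂ nl₂ (len e₃) e₃)
  mergeNf-assoc (suc fuel) nil _ {nl₁} _ {e₂} {nl₂} ne₂ w₂ le₂ {e₃} ne₃ w₃ _ = begin
    mergeNf (mergeNf nil nl₁ (len e₂) e₂) (nl₂ + (nl₁ ∸ len e₂)) (len e₃) e₃
      ≡⟨ cong (λ e → mergeNf e (nl₂ + (nl₁ ∸ len e₂)) (len e₃) e₃) (mergeNf-nil nl₁ (len e₂) ne₂) ⟩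
    mergeNf (drop nl₁ e₂) (nl₂ + (nl₁ ∸ len e₂)) (len e₃) e₃
      ≡⟨ drop-mergeNf nl₁ ne₂ w₂ le₂ ne₃ ⟨
    drop nl₁ (mergeNf e₂ nl₂ (len e₃) e₃)
      ≡⟨ mergeNf-nil nl₁ _ (mergeNf-normal ne₂ w₂ le₂ ne₃ w₃) ⟨
    mergeNf nil nl₁ (len e₂ + (len e₃ ∸ nl₂)) (mergeNf e₂ nl₂ (len e₃) e₃) ∎
    where open ≡-Reasoning
  mergeNf-assoc (suc fuel) {cons t n e₁} ne₁@(cons nt ne₁') w₁@(wf-cons wt w₁' le) {nl₁} le₁
                {e₂} {nl₂} ne₂ w₂ le₂ {e₃} ne₃ w₃ h = begin
    mergeNf (mergeNf (cons t n e₁) nl₁ (len e₂) e₂) N (len e₃) e₃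
      ≡⟨ cong (λ e → mergeNf e N (len e₃) e₃) merge₁₂ ⟩
    mergeNf (consEntry head₁₂ tail₁₂) N (len e₃) e₃
      ≡⟨ mergeNf-cons (mergeNf-normal ne₁' w₁' (≤-trans le le₁) ne₂ w₂) lev-tail₁₂ level₁₂≤N ne₃ ⟩
    consEntry (mergeEntry (proj₁ head₁₂) (proj₂ head₁₂) (drop (N ∸ proj₂ head₁₂) e₃))
              (mergeNf tail₁₂ N (len e₃) e₃)
      ≡⟨ cong₂ consEntry (mergeEntry-assoc fuel nt wt le₁ ne₂ w₂ le₂ ne₃ w₃ (drop-normal (nl₁ ∸ n) ne₂) refl h-head)
                         (trans (mergeNf-assoc fuel ne₁' w₁' (≤-trans le le₁) ne₂ w₂ le₂ ne₃ w₃ h-tail)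
                                (cong (λ o → mergeNf e₁ nl₁ o e₂₃) (sym len-e₂₃))) ⟩
    consEntry (mergeEntry t n (drop (nl₁ ∸ n) e₂₃)) (mergeNf e₁ nl₁ (len e₂₃) e₂₃)
      ≡⟨ mergeNf-cons ne₁' le le₁ (mergeNf-normal ne₂ w₂ le₂ ne₃ w₃) ⟨
    mergeNf (cons t n e₁) nl₁ (len e₂₃) e₂₃
      ≡⟨ cong (λ o → mergeNf (cons t n e₁) nl₁ o e₂₃) len-e₂₃ ⟩
    mergeNf (cons t n e₁) nl₁ (len e₂ + (len e₃ ∸ nl₂)) e₂₃ ∎
    where
    open ≡-Reasoning
    N = nl₂ + (nl₁ ∸ len e₂)
    e₂₃ = mergeNf e₂ nl₂ (len e₃) e₃
    len-e₂₃ : len e₂₃ ≡ len e₂ + (len e₃ ∸ nl₂)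
    len-e₂₃ = len-mergeNf ne₂ w₂ le₂ ne₃ w₃
    head₁₂ = mergeEntry t n (drop (nl₁ ∸ n) e₂)
    tail₁₂ = mergeNf e₁ nl₁ (len e₂) e₂
    merge₁₂ : mergeNf (cons t n e₁) nl₁ (len e₂) e₂ ≡ consEntry head₁₂ tail₁₂
    merge₁₂ = mergeNf-cons ne₁' le le₁ ne₂
    lev-tail₁₂ : lev tail₁₂ ≤ proj₂ head₁₂
    lev-tail₁₂ with subst WF merge₁₂ (mergeNf-WF ne₁ w₁ le₁ ne₂ w₂)
    ... | wf-cons _ _ q = q
    level₁₂≤N : proj₂ head₁₂ ≤ N
    level₁₂≤N = ≤-trans (subst (λ e → lev e ≤ lev e₂ + (nl₁ ∸ len e₂)) merge₁₂
                               (lev-mergeNf ne₁ w₁ le₁ ne₂ w₂))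
                        (+-monoˡ-≤ _ le₂)
    h-tail : size e₁ + size e₂ + size e₃ < fuel
    h-tail = spend (<-of-≡ (size t) (size-consʳ (size t) (size e₁) (size e₂) (size e₃))) h
    h-head : size t + size e₂ + size e₃ < fuel
    h-head = spend (<-of-≡ (size e₁) (size-consˡ (size t) (size e₁) (size e₂) (size e₃))) h

  mergeEntry-assoc : ∀ fuel {t n} → NormalTm t → WF t → ∀ {nl₁} → n ≤ nl₁ →
                     ∀ {e₂ nl₂} → NormalEnv e₂ → WF e₂ → lev e₂ ≤ nl₂ →
                     ∀ {e₃} → NormalEnv e₃ → WF e₃ → ∀ {rest} → NormalEnv rest → drop (nl₁ ∸ n) e₂ ≡ rest →
                     size t + size e₂ + size e₃ < fuel →
                     mergeEntry (proj₁ (mergeEntry t n rest)) (proj₂ (mergeEntry t n rest))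
                                (drop ((nl₂ + (nl₁ ∸ len e₂)) ∸ proj₂ (mergeEntry t n rest)) e₃) ≡
                     mergeEntry t n (drop (nl₁ ∸ n) (mergeNf e₂ nl₂ (len e₃) e₃))
  mergeEntry-assoc fuel {t} {n} _ _ {nl₁} n≤nl₁ {e₂} {nl₂} ne₂ w₂ le₂ {e₃} ne₃ _ nil eq _ =
    cong (mergeEntry t n) (sym (begin
      drop (nl₁ ∸ n) (mergeNf e₂ nl₂ (len e₃) e₃)
        ≡⟨ drop-mergeNf (nl₁ ∸ n) ne₂ w₂ le₂ ne₃ ⟩
      mergeNf (drop (nl₁ ∸ n) e₂) (nl₂ + ((nl₁ ∸ n) ∸ len e₂)) (len e₃) e₃
        ≡⟨ cong (λ e → mergeNf e (nl₂ + ((nl₁ ∸ n) ∸ len e₂)) (len e₃) e₃) eq ⟩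
      mergeNf nil (nl₂ + ((nl₁ ∸ n) ∸ len e₂)) (len e₃) e₃
        ≡⟨ mergeNf-nil _ (len e₃) ne₃ ⟩
      drop (nl₂ + ((nl₁ ∸ n) ∸ len e₂)) e₃
        ≡⟨ cong (λ x → drop x e₃)
                ([o+[m∸p]]∸n≡o+[[m∸n]∸p] nl₂ n≤nl₁ (drop≡nil⇒len≤ (nl₁ ∸ n) ne₂ eq)) ⟨
      drop ((nl₂ + (nl₁ ∸ len e₂)) ∸ n) e₃ ∎))
    where open ≡-Reasoning
  mergeEntry-assoc fuel {t} {n} nt wt {nl₁} n≤nl₁ {e₂} {nl₂} ne₂ w₂ le₂ {e₃} ne₃ w₃
                   {rest} nr@(cons {l = l} {rest'} _ _) eq h =
    trans (cong (λ x → mergeEntry (suspNf t (suc (len rest')) l rest) (l + (n ∸ suc (len rest'))) (drop x e₃)) index≡)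
          (trans (mergeEntry-assoc-cons fuel nt wt nr wr l≤nl₂ ne₃ w₃ (drop-normal (nl₂ ∸ l) ne₃) refl h')
                 (cong (mergeEntry t n) (sym drop-e₂₃)))
    where
    d = nl₁ ∸ n
    wr : WF rest
    wr = subst WF eq (drop-WF d w₂)
    len-rest : len rest ≡ len e₂ ∸ d
    len-rest = trans (cong len (sym eq)) (len-drop d ne₂)
    l≤nl₂ : l ≤ nl₂
    l≤nl₂ = ≤-trans (subst (λ e → lev e ≤ lev e₂) eq (lev-drop d w₂)) le₂
    d<len : d < len e₂
    d<len = drop-cons⇒<len d ne₂ eq
    index≡ : (nl₂ + (nl₁ ∸ len e₂)) ∸ (l + (n ∸ suc (len rest'))) ≡ nl₂ ∸ l
    index≡ = trans (cong (λ x → (nl₂ + (nl₁ ∸ len e₂)) ∸ (l + (n ∸ x))) len-rest)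
                   (trans (cong (λ x → (nl₂ + (nl₁ ∸ len e₂)) ∸ (l + x)) (n∸[p∸[m∸n]]≡m∸p n≤nl₁ d<len))
                          ([m+o]∸[n+o]≡m∸n nl₂ l (nl₁ ∸ len e₂)))
    drop-e₂₃ : drop d (mergeNf e₂ nl₂ (len e₃) e₃) ≡ mergeNf rest nl₂ (len e₃) e₃
    drop-e₂₃ = trans (drop-mergeNf d ne₂ w₂ le₂ ne₃)
                     (cong₂ (λ e x → mergeNf e x (len e₃) e₃) eq
                            (trans (cong (nl₂ +_) (m≤n⇒m∸n≡0 (<⇒≤ d<len))) (+-identityʳ nl₂)))
    h' : size t + size rest + size e₃ < fuel
    h' = ≤-<-trans (+-monoˡ-≤ (size e₃) (+-monoʳ-≤ (size t) (subst (λ e → size e ≤ size e₂) eq (size-drop d e₂)))) h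

  mergeEntry-assoc-cons : ∀ fuel {t n} → NormalTm t → WF t →
                          ∀ {s l rest} → NormalEnv (cons s l rest) → WF (cons s l rest) → ∀ {nl₂} → l ≤ nl₂ →
                          ∀ {e₃} → NormalEnv e₃ → WF e₃ →
                          ∀ {rest₃} → NormalEnv rest₃ → drop (nl₂ ∸ l) e₃ ≡ rest₃ →
                          size t + size (cons s l rest) + size e₃ < fuel →
                          mergeEntry (suspNf t (suc (len rest)) l (cons s l rest)) (l + (n ∸ suc (len rest))) rest₃ ≡
                          mergeEntry t n (mergeNf (cons s l rest) nl₂ (len e₃) e₃)
  mergeEntry-assoc-cons fuel {t} {n} _ _ {l = l} nf wf {nl₂} l≤nl₂ {e₃} ne₃ _ nil eq _ =
    sym (cong (mergeEntry t n) (mergeNf-exhausted nf wf l≤nl₂ ne₃ (drop≡nil⇒len≤ (nl₂ ∸ l) ne₃ eq)))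
  mergeEntry-assoc-cons fuel {t} {n} nt wt {s} {l} {rest} nf@(cons _ nr) wf@(wf-cons _ wr le) {nl₂} l≤nl₂ {e₃} ne₃ w₃
                        {rest₃} nr₃@(cons {l = m} _ _) eq h =
    trans (cong₂ _,_
            (trans (suspNf-assoc fuel nt wt nf wf ≤-refl nr₃ wr₃ ≤-refl h')
                   (cong₂ (λ ol e → suspNf t ol (m + (l ∸ len rest₃)) e) len≡ merge-rest₃))
            level≡)
          (sym (cong (mergeEntry t n) merge-e₃))
    where
    f = cons s l rest
    d = nl₂ ∸ l
    tail = mergeNf rest nl₂ (len e₃) e₃
    merged = cons (suspNf s (len rest₃) m rest₃) (m + (l ∸ len rest₃)) tail
    merge-e₃ : mergeNf f nl₂ (len e₃) e₃ ≡ merged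
    merge-e₃ = trans (mergeNf-cons nr le l≤nl₂ ne₃) (cong (λ e → consEntry (mergeEntry s l e) tail) eq)
    wr₃ : WF rest₃
    wr₃ = subst WF eq (drop-WF d w₃)
    len-rest₃ : len rest₃ ≡ len e₃ ∸ d
    len-rest₃ = trans (cong len (sym eq)) (len-drop d ne₃)
    merge-rest₃ : mergeNf f l (len rest₃) rest₃ ≡ merged
    merge-rest₃ = begin
      mergeNf f l (len rest₃) rest₃      ≡⟨ cong₂ (mergeNf f l) len-rest₃ (sym eq) ⟩
      mergeNf f l (len e₃ ∸ d) (drop d e₃) ≡⟨ mergeNf-drop d nf ≤-refl (len e₃) ne₃ ⟨
      mergeNf f (d + l) (len e₃) e₃      ≡⟨ cong (λ x → mergeNf f x (len e₃) e₃) (m∸n+n≡m l≤nl₂) ⟩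
      mergeNf f nl₂ (len e₃) e₃          ≡⟨ merge-e₃ ⟩
      merged                             ∎
      where open ≡-Reasoning
    len≡ : len f + (len rest₃ ∸ l) ≡ suc (len tail)
    len≡ = trans (cong (λ x → len f + (x ∸ l)) len-rest₃)
                 (trans (cong (len f +_) ([o∸[n∸m]]∸m≡o∸n (len e₃) l≤nl₂))
                        (trans (sym (len-mergeNf nf wf l≤nl₂ ne₃ w₃)) (cong len merge-e₃)))
    level≡ : m + ((l + (n ∸ suc (len rest))) ∸ len rest₃) ≡ (m + (l ∸ len rest₃)) + (n ∸ suc (len tail))
    level≡ = trans (cong (m +_) ([m+n]∸o≡[m∸o]+[n∸[o∸m]] l (n ∸ suc (len rest)) (len rest₃)))
                   (trans (sym (+-assoc m _ _))
                          (cong ((m + (l ∸ len rest₃)) +_)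
                                (trans (∸-+-assoc n (suc (len rest)) (len rest₃ ∸ l)) (cong (n ∸_) len≡))))
    h' : size t + size f + size rest₃ < fuel
    h' = ≤-<-trans (+-monoʳ-≤ (size t + size f) (subst (λ e → size e ≤ size e₃) eq (size-drop d e₃))) h

-- Invariance of nf

▷⇒nf≡ : ∀ {σ} {x y : Exp σ} → x ▷ y → WF x → nf x ≡ nf y
▷⇒nf≡ r1 _ = refl
▷⇒nf≡ r2 _ = refl
▷⇒nf≡ (r3 {nl = nl} {l = l}) (wf-susp _ (wf-cons wt _ _) _ _) = shiftNf≡suspNf 0 (nl ∸ l) (nf-normal wt) (nf-WF wt)
▷⇒nf≡ (r4 (s≤s (s≤s _))) _ = refl
▷⇒nf≡ r5 _ = refl
▷⇒nf≡ r6 _ = refl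
▷⇒nf≡ m1 (wf-susp (wf-susp wt we₁ refl le₁) we₂ refl le₂)
  rewrite sym (▷*-len (▷*-nf we₁) we₁) | sym (▷*-len (▷*-nf we₂) we₂) =
  suspNf-assoc _ (nf-normal wt) (nf-WF wt) (nf-normal we₁) (nf-WF we₁) (≤-trans (nf-lev we₁) le₁)
                 (nf-normal we₂) (nf-WF we₂) (≤-trans (nf-lev we₂) le₂) ≤-refl
▷⇒nf≡ m2 _ = refl
▷⇒nf≡ (m3 {ol₂ = ol}) (wf-menv _ w₂ _ _) = mergeNf-nil 0 ol (nf-normal w₂)
▷⇒nf≡ (m4 (s≤s _)) _ = refl
▷⇒nf≡ (m5 p) _ = mergeNf-cons-< p
▷⇒nf≡ (m6 {t} {n} {e₁} {ol₂} {s} {l} {e₂}) _ = mergeNf-cons-≡ {nf t} {n} {nf e₁} {ol₂} {nf s} {l} {nf e₂}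
▷⇒nf≡ (app₁ r) (wf-app w _) = cong (λ t → app t _) (▷⇒nf≡ r w)
▷⇒nf≡ (app₂ r) (wf-app _ w) = cong (app _) (▷⇒nf≡ r w)
▷⇒nf≡ (lam₁ r) (wf-lam w) = cong lam (▷⇒nf≡ r w)
▷⇒nf≡ (susp₁ r) (wf-susp w _ _ _) = cong (λ t → suspNf t _ _ _) (▷⇒nf≡ r w)
▷⇒nf≡ (susp₂ {t} {ol} {nl} r) (wf-susp _ w _ _) = cong (suspNf (nf t) ol nl) (▷⇒nf≡ r w)
▷⇒nf≡ (cons₁ r) (wf-cons w _ _) = cong (λ t → cons t _ _) (▷⇒nf≡ r w)
▷⇒nf≡ (cons₂ r) (wf-cons _ w _) = cong (cons _ _) (▷⇒nf≡ r w)
▷⇒nf≡ (menv₁ {nl = nl} {ol} {e₂} r) (wf-menv w _ _ _) = cong (λ e → mergeNf e nl ol (nf e₂)) (▷⇒nf≡ r w)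
▷⇒nf≡ (menv₂ {e₁} {nl} {ol} r) (wf-menv _ w _ _) = cong (mergeNf (nf e₁) nl ol) (▷⇒nf≡ r w)

▷*⇒nf≡ : ∀ {σ} {x y : Exp σ} → x ▷* y → WF x → nf x ≡ nf y
▷*⇒nf≡ ε _ = refl
▷*⇒nf≡ (r ◅ rs) w = trans (▷⇒nf≡ r w) (▷*⇒nf≡ rs (▷-WF r w))

theorem3p12 : ∀ {σ : Sort} (s u v : Exp σ) → WF s → WF u → WF v
            → s ▷* u → s ▷* v
            → ∃ λ t → (u ▷* t) × (v ▷* t)
theorem3p12 s u v ws wu wv s▷*u s▷*v = nf u , ▷*-nf wu , ▷*-nf wv ◅◅ ≡⇒▷* nf-v≡nf-u
  where
  nf-v≡nf-u : nf v ≡ nf u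
  nf-v≡nf-u = trans (sym (▷*⇒nf≡ s▷*v ws)) (▷*⇒nf≡ s▷*u ws)
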